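{- Let $q$ be a power of two, $A$ a $q$-modular witness in a graph $G$, $U\subseteq A$, and $n_B=|\{x\in A\setminus U:N(x)\cap U=B\}|$ for $B\subseteq U$. Choose a lift $d$ modulo $2q$ of the common residue modulo $q$ of the degrees $\deg_A(v)$, and define $b_A(v)\in\{0,1\}$ by $\deg_A(v)\equiv d+qb_A(v)\pmod{2q}$. Then there is NO family of pairwise disjoint $q$-element subsets of $A\setminus U$, each consisting of vertices with a common trace on $U$, whose deletion (leaving $W$) makes all $\deg_W(u)$, $u\in U$, congruent modulo $2q$, if and only if there exists a nonempty $Y\subseteq U$ with $|Y|\equiv0\pmod2$, $\sum_{u\in Y}b_A(u)\equiv1\pmod2$, and $|B\cap Y|\equiv0\pmod2$ for every $B\subseteq U$ with $n_B\ge q$. Equivalently, for the fixed core $U$ exactly one of the following holds: (1) such a deletion family exists; (2) such an even set $Y$ exists.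
   Context: Graphs are finite simple; $\deg_S(v)$ is the degree of $v$ in $G[S]$; $S$ is $q$-modular if all $\deg_S(v)$, $v\in S$, are congruent modulo $q$. The trace of $x$ on $U$ is $N(x)\cap U$. -}

module Defs where

open import Data.Nat using (ℕ; _+_; _*_)
open import Data.Bool using (Bool; true; false; _∧_) renaming (_≟_ to _≟ᵇ_)
open import Data.Fin using (Fin)
open import Data.Fin.Subset using (Subset; _∈_; _∩_; _─_; ∣_∣; Empty)
open import Data.Vec using (tabulate; lookup)
open import Data.Vec.Properties using (≡-dec)
open import Data.List using (List; foldr)
open import Data.Product using (Σ; _×_)
open import Data.List.Relation.Unary.All using (All)
open import Data.List.Relation.Unary.AllPairs using (AllPairs)
open import Data.Fin.Subset using (_⊆_; Nonempty)
open import Data.Nat using (_≤_)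
open import Relation.Nullary.Decidable using (⌊_⌋)
open import Relation.Binary.PropositionalEquality using (_≡_)

record Graph (n : ℕ) : Set where
  field
    adj    : Fin n → Fin n → Bool
    sym    : ∀ u v → adj u v ≡ adj v u
    irrefl : ∀ v → adj v v ≡ false
open Graph public

_≡_[mod_] : ℕ → ℕ → ℕ → Set
a ≡ b [mod q ] = Σ ℕ λ s → Σ ℕ λ t → a + s * q ≡ b + t * q

N : ∀ {n} → Graph n → Fin n → Subset n
N G v = tabulate (adj G v)

deg : ∀ {n} → Graph n → Subset n → Fin n → ℕ
deg G S v = ∣ S ∩ N G v ∣

Modular : ∀ {n} → Graph n → ℕ → Subset n → Set
Modular G q S = ∀ u v → u ∈ S → v ∈ S → deg G S u ≡ deg G S v [mod q ]

trace : ∀ {n} → Graph n → Fin n → Subset n → Subset n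
trace G x U = N G x ∩ U

nB : ∀ {n} → Graph n → Subset n → Subset n → Subset n → ℕ
nB G A U B = ∣ tabulate (λ x → lookup (A ─ U) x ∧ ⌊ ≡-dec _≟ᵇ_ (trace G x U) B ⌋) ∣

⋃ : ∀ {n} → List (Subset n) → Subset n
⋃ {n} = foldr _∪'_ Data.Fin.Subset.⊥
  where open import Data.Fin.Subset using () renaming (_∪_ to _∪'_)

Disjoint : ∀ {n} → Subset n → Subset n → Set
Disjoint X Y = Empty (X ∩ Y)

DeletionFamily : ∀ {n} → Graph n → ℕ → Subset n → Subset n → List (Subset n) → Set
DeletionFamily G q A U Xs =
  AllPairs Disjoint Xs
  × All (λ X → (X ⊆ (A ─ U)) × (∣ X ∣ ≡ q)
               × (∀ x y → x ∈ X → y ∈ X → trace G x U ≡ trace G y U)) Xs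
  × (∀ u v → u ∈ U → v ∈ U →
       deg G (A ─ ⋃ Xs) u ≡ deg G (A ─ ⋃ Xs) v [mod 2 * q ])

EvenObstruction : ∀ {n} → Graph n → ℕ → Subset n → Subset n → (Fin n → Bool) → Subset n → Set
EvenObstruction G q A U b Y =
  (Y ⊆ U) × Nonempty Y
  × (∣ Y ∣ ≡ 0 [mod 2 ])
  × (∣ Y ∩ tabulate b ∣ ≡ 1 [mod 2 ])
  × (∀ B → B ⊆ U → q ≤ nB G A U B → ∣ B ∩ Y ∣ ≡ 0 [mod 2 ])

-- Deleting q vertices that all have trace B on U lowers deg(u), u ∈ U, by q·[u ∈ B]. Since
-- deg_A(u) ≡ d + q·b(u) (mod 2q), after deleting blocks with traces B₁, …, Bₘ we get
-- deg_W(u) ≡ d + q·(b(u) + Σᵢ [u ∈ Bᵢ]) (mod 2q), so the deletion works iff b + B₁ + ⋯ + Bₘ is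
-- constant on U over GF(2), i.e. iff b restricted to U is a sum of distinct traces B with
-- n_B ≥ q and possibly U itself. By the Fredholm alternative over GF(2) this fails iff some y
-- is orthogonal to U and to every such B but not to b restricted to U, and then U ∩ y is an
-- even obstruction.
module Submission where

open import Defs hiding (sym)
open import Data.Nat using (ℕ; zero; suc; _+_; _*_; _^_; _≤_; _≤?_; s≤s⁻¹; NonZero; ≢-nonZero⁻¹)
open import Data.Nat.Properties
  using (+-assoc; +-comm; +-suc; +-identityʳ; +-cancelˡ-≡; *-cancelˡ-≡; *-comm; *-identityʳ; *-zeroʳ;
         *-distribˡ-+; even≢odd; m^n≢0)
open import Data.Nat.ListAction using (sum)
open import Data.Nat.Tactic.RingSolver using (solve-∀)
open import Data.Bool using (Bool; true; false; if_then_else_; _∧_; _xor_) renaming (_≟_ to _≟ᵇ_)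
open import Data.Bool.Properties
  using (xor-∧-commutativeRing; xor-assoc; xor-same; xor-identityʳ; ∧-distribʳ-xor; ∧-identityʳ; T-≡)
open import Data.Fin using (Fin)
open import Data.Fin.Subset
  using (Subset; inside; outside; _∈_; _∉_; _⊆_; _∩_; _─_; ⊥; ⁅_⁆; ∣_∣; Nonempty)
open import Data.Fin.Subset.Properties
  using (_⊆?_; ⊆-antisym; drop-∷-⊆; s⊆s; ⊥⊆; ∣⊥∣≡0; ∉⊥; ∣⁅x⁆∣≡1; x∈⁅y⁆⇒x≡y;
         p∩q⊆p; p∩q⊆q; x∈p∩q⁺; x∈p∩q⁻; x∈p∪q⁻; ∩-comm; ∩-assoc; ∩-zeroˡ;
         nonempty?; Empty-unique; p⊆q⇒∣p∣≤∣q∣;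
         p─q⊆p; x∈p∧x∉q⇒x∈p─q; p─⊥≡p; p─q─r≡p─r─q; p─q─r≡p─q∪r)
open import Data.Vec using ([]; _∷_; here; lookup; tabulate; zipWith)
open import Data.Vec.Properties
  using ([]=⇒lookup; lookup⇒[]=; lookup∘tabulate; lookup-zipWith; lookup-replicate; ∷-injective; ≡-dec)
open import Data.List using (List; []; _∷_; foldr; map; filter; cartesianProductWith)
open import Data.List.Membership.Propositional using () renaming (_∈_ to _∈ₗ_)
open import Data.List.Membership.Propositional.Properties using (∈-cartesianProductWith⁺; ∈-filter⁺)
import Data.List.Relation.Unary.Any as Any
open import Data.List.Relation.Unary.All as All using (All; []; _∷_)
import Data.List.Relation.Unary.All.Properties as Allₚ
open import Data.List.Relation.Unary.AllPairs as AllPairs using (AllPairs; []; _∷_)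
import Data.List.Relation.Unary.AllPairs.Properties as AllPairsₚ
open import Data.List.Relation.Unary.Unique.Propositional using (Unique)
import Data.List.Relation.Unary.Unique.Propositional.Properties as Uniqueₚ
open import Data.List.Relation.Binary.Pointwise using (Pointwise; []; _∷_)
open import Data.List.Relation.Binary.Sublist.Propositional using ([]; _∷_; _∷ʳ_) renaming (_⊆_ to _⊑_)
open import Data.List.Relation.Binary.Sublist.Propositional.Properties using (All-resp-⊆)
open import Data.Product using (Σ; ∃-syntax; _×_; _,_; proj₁; proj₂)
open import Data.Sum using (_⊎_; inj₁; inj₂; fromInj₂)
open import Data.Empty using (⊥-elim)
open import Function using (_∘_)
open import Function.Bundles using (_⇔_; mk⇔; Equivalence)
open import Relation.Nullary using (¬_; yes; no; contradiction; _×-dec_)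
open import Relation.Nullary.Decidable using (⌊_⌋; fromWitness)
open import Relation.Unary using (Decidable)
open import Relation.Binary.Core using (Rel)
open import Relation.Binary.Bundles using (Setoid)
open import Relation.Binary.Structures using (IsEquivalence)
open import Relation.Binary.PropositionalEquality
  using (_≡_; _≢_; refl; sym; trans; cong; cong₂; subst; module ≡-Reasoning)
import Relation.Binary.Reasoning.Setoid as ≈-Reasoning
open import Algebra.Bundles using (CommutativeRing)
open import Algebra.Properties.CommutativeSemigroup
  (CommutativeRing.+-commutativeSemigroup xor-∧-commutativeRing) using (interchange)

private
  variable
    n : ℕ

bit : Bool → ℕ
bit b = if b then 1 else 0

private
  scale : ∀ m c a s → c * a + s * (m * c) ≡ c * (a + s * m)
  scale = solve-∀

-- _≡_[mod_] has the default precedence 20, so a left operand built with _+_ or _*_ needs parentheses.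
module _ {m : ℕ} where

  ≡⇒≡-mod : ∀ {a b} → a ≡ b → a ≡ b [mod m ]
  ≡⇒≡-mod a≡b = 0 , 0 , cong (_+ 0) a≡b

  mod-sym : ∀ {a b} → a ≡ b [mod m ] → b ≡ a [mod m ]
  mod-sym (s , t , e) = t , s , sym e

  mod-trans : ∀ {a b c} → a ≡ b [mod m ] → b ≡ c [mod m ] → a ≡ c [mod m ]
  mod-trans {a} {b} {c} (s , t , e) (s′ , t′ , e′) = s + s′ , t′ + t , (begin
    a + (s + s′) * m      ≡⟨ shift a s s′ m ⟩
    (a + s * m) + s′ * m  ≡⟨ cong (_+ s′ * m) e ⟩
    (b + t * m) + s′ * m  ≡⟨ swap b t s′ m ⟩
    (b + s′ * m) + t * m  ≡⟨ cong (_+ t * m) e′ ⟩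
    (c + t′ * m) + t * m  ≡⟨ sym (shift c t′ t m) ⟩
    c + (t′ + t) * m      ∎)
    where
    open ≡-Reasoning
    shift : ∀ a s s′ m → a + (s + s′) * m ≡ (a + s * m) + s′ * m
    shift = solve-∀
    swap : ∀ b t s′ m → (b + t * m) + s′ * m ≡ (b + s′ * m) + t * m
    swap = solve-∀

  mod-isEquivalence : IsEquivalence (_≡_[mod m ])
  mod-isEquivalence = record { refl = ≡⇒≡-mod refl ; sym = mod-sym ; trans = mod-trans }

  +-cong-mod : ∀ {a b c e} → a ≡ b [mod m ] → c ≡ e [mod m ] → (a + c) ≡ b + e [mod m ]
  +-cong-mod {a} {b} {c} {e} (s , t , a≡b) (s′ , t′ , c≡e) = s + s′ , t + t′ , (begin
    a + c + (s + s′) * m        ≡⟨ regroup a c s s′ m ⟩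
    (a + s * m) + (c + s′ * m)  ≡⟨ cong₂ _+_ a≡b c≡e ⟩
    (b + t * m) + (e + t′ * m)  ≡⟨ sym (regroup b e t t′ m) ⟩
    b + e + (t + t′) * m        ∎)
    where
    open ≡-Reasoning
    regroup : ∀ a c s s′ m → a + c + (s + s′) * m ≡ (a + s * m) + (c + s′ * m)
    regroup = solve-∀

  +-cancelˡ-mod : ∀ {a b} c → (c + a) ≡ c + b [mod m ] → a ≡ b [mod m ]
  +-cancelˡ-mod {a} {b} c (s , t , e) = s , t , +-cancelˡ-≡ c _ _
    (trans (sym (+-assoc c a (s * m))) (trans e (+-assoc c b (t * m))))

  *-congˡ-mod : ∀ {a b} c → a ≡ b [mod m ] → (c * a) ≡ c * b [mod m * c ]
  *-congˡ-mod {a} {b} c (s , t , e) = s , t , trans (scale m c a s) (trans (cong (c *_) e) (sym (scale m c b t)))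

  *-cancelˡ-mod : ∀ {a b} c .{{_ : NonZero c}} → (c * a) ≡ c * b [mod m * c ] → a ≡ b [mod m ]
  *-cancelˡ-mod {a} {b} c (s , t , e) =
    s , t , *-cancelˡ-≡ _ _ c (trans (sym (scale m c a s)) (trans e (scale m c b t)))

mod-setoid : ℕ → Setoid _ _
mod-setoid m = record { isEquivalence = mod-isEquivalence {m} }

bit-+-mod2 : ∀ x y → (bit x + bit y) ≡ bit (x xor y) [mod 2 ]
bit-+-mod2 true  true  = 0 , 1 , refl
bit-+-mod2 true  false = ≡⇒≡-mod refl
bit-+-mod2 false y     = ≡⇒≡-mod refl

bit-injective-mod2 : ∀ {x y} → bit x ≡ bit y [mod 2 ] → x ≡ y
bit-injective-mod2 {true}  {true}  _           = refl
bit-injective-mod2 {false} {false} _           = refl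
bit-injective-mod2 {true}  {false} (s , t , e) =
  ⊥-elim (even≢odd t s (trans (*-comm 2 t) (trans (sym e) (cong suc (*-comm s 2)))))
bit-injective-mod2 {false} {true}  (s , t , e) =
  ⊥-elim (even≢odd s t (trans (*-comm 2 s) (trans e (cong suc (*-comm t 2)))))

xor-cancelʳ : ∀ x y → (x xor y) xor y ≡ x
xor-cancelʳ x y = trans (xor-assoc x y y) (trans (cong (x xor_) (xor-same y)) (xor-identityʳ x))

remove-bit-mod : ∀ {w r D d} q β μ → w + r ≡ D → r ≡ q * bit μ [mod 2 * q ] →
                 D ≡ d + q * bit β [mod 2 * q ] → w ≡ d + q * bit (β xor μ) [mod 2 * q ]
remove-bit-mod {w} {r} {D} {d} q β μ w+r≡D r≡qμ D≡d+qβ = +-cancelˡ-mod (q * bit μ) (begin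
  q * bit μ + w                       ≡⟨ +-comm (q * bit μ) w ⟩
  w + q * bit μ                       ≈⟨ +-cong-mod (≡⇒≡-mod refl) (mod-sym r≡qμ) ⟩
  w + r                               ≡⟨ w+r≡D ⟩
  D                                   ≈⟨ D≡d+qβ ⟩
  d + q * bit β                       ≈⟨ +-cong-mod (≡⇒≡-mod refl) qβ≡q[β⊕μ]+qμ ⟩
  d + (q * bit (β xor μ) + q * bit μ) ≡⟨ rotate d (q * bit (β xor μ)) (q * bit μ) ⟩
  q * bit μ + (d + q * bit (β xor μ)) ∎)
  where
  open ≈-Reasoning (mod-setoid (2 * q))
  rotate : ∀ d a c → d + (a + c) ≡ c + (d + a)
  rotate = solve-∀
  qβ≡q[β⊕μ]+qμ : (q * bit β) ≡ q * bit (β xor μ) + q * bit μ [mod 2 * q ]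
  qβ≡q[β⊕μ]+qμ = mod-trans (*-congˡ-mod q (mod-sym bits))
                           (≡⇒≡-mod (*-distribˡ-+ q (bit (β xor μ)) (bit μ)))
    where
    bits : (bit (β xor μ) + bit μ) ≡ bit β [mod 2 ]
    bits = subst (λ z → (bit (β xor μ) + bit μ) ≡ bit z [mod 2 ]) (xor-cancelʳ β μ)
                 (bit-+-mod2 (β xor μ) μ)

d+q*bit-injective : ∀ d q .{{_ : NonZero q}} {x y} → (d + q * bit x) ≡ d + q * bit y [mod 2 * q ] → x ≡ y
d+q*bit-injective d q = bit-injective-mod2 ∘ *-cancelˡ-mod q ∘ +-cancelˡ-mod d

p⊆q⇒p∩q≡p : {p q : Subset n} → p ⊆ q → p ∩ q ≡ p
p⊆q⇒p∩q≡p {p = p} {q} p⊆q = ⊆-antisym (p∩q⊆p p q) (λ x∈p → x∈p∩q⁺ (x∈p , p⊆q x∈p))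

keepFirst : ℕ → Subset n → Subset n
keepFirst zero    _             = ⊥
keepFirst (suc k) []            = []
keepFirst (suc k) (inside ∷ p)  = inside ∷ keepFirst k p
keepFirst (suc k) (outside ∷ p) = outside ∷ keepFirst (suc k) p

keepFirst-⊆ : ∀ k (p : Subset n) → keepFirst k p ⊆ p
keepFirst-⊆ zero    _             = ⊥⊆
keepFirst-⊆ (suc k) []            = λ ()
keepFirst-⊆ (suc k) (inside ∷ p)  = s⊆s (keepFirst-⊆ k p)
keepFirst-⊆ (suc k) (outside ∷ p) = s⊆s (keepFirst-⊆ (suc k) p)

∣keepFirst∣ : ∀ {k} (p : Subset n) → k ≤ ∣ p ∣ → ∣ keepFirst k p ∣ ≡ k
∣keepFirst∣ {n} {zero}  _             _   = ∣⊥∣≡0 n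
∣keepFirst∣ {k = suc k} (inside ∷ p)  k<p = cong suc (∣keepFirst∣ p (s≤s⁻¹ k<p))
∣keepFirst∣ {k = suc k} (outside ∷ p) k<p = ∣keepFirst∣ p k<p

∩-constant : ∀ {c} {p q : Subset n} → (∀ {x} → x ∈ p → lookup q x ≡ c) →
             p ∩ q ≡ (if c then p else ⊥)
∩-constant {c = true}  {q = q} const = p⊆q⇒p∩q≡p (λ x∈p → lookup⇒[]= _ q (const x∈p))
∩-constant {c = false} {p} {q} const = Empty-unique λ (x , x∈p∩q) →
  let x∈p , x∈q = x∈p∩q⁻ p q x∈p∩q in contradiction (trans (sym ([]=⇒lookup x∈q)) (const x∈p)) λ ()

∣p∩r∣-split : ∀ {p q : Subset n} r → q ⊆ p → ∣ p ∩ r ∣ ≡ ∣ (p ─ q) ∩ r ∣ + ∣ q ∩ r ∣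
∣p∩r∣-split {p = []}          {[]}          []            _   = refl
∣p∩r∣-split {p = inside ∷ p}  {inside ∷ q}  (inside ∷ r)  q⊆p =
  trans (cong suc (∣p∩r∣-split r (drop-∷-⊆ q⊆p))) (sym (+-suc _ _))
∣p∩r∣-split {p = inside ∷ p}  {inside ∷ q}  (outside ∷ r) q⊆p = ∣p∩r∣-split r (drop-∷-⊆ q⊆p)
∣p∩r∣-split {p = inside ∷ p}  {outside ∷ q} (inside ∷ r)  q⊆p =
  cong suc (∣p∩r∣-split r (drop-∷-⊆ q⊆p))
∣p∩r∣-split {p = inside ∷ p}  {outside ∷ q} (outside ∷ r) q⊆p = ∣p∩r∣-split r (drop-∷-⊆ q⊆p)
∣p∩r∣-split {p = outside ∷ p} {outside ∷ q} (_ ∷ r)       q⊆p = ∣p∩r∣-split r (drop-∷-⊆ q⊆p)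
∣p∩r∣-split {p = outside ∷ p} {inside ∷ q}  _             q⊆p with () ← q⊆p here

∉⋃ : ∀ {x} {X : Subset n} Xs → All (Disjoint X) Xs → x ∈ X → x ∉ ⋃ Xs
∉⋃ []       []               _   = ∉⊥
∉⋃ (Y ∷ Ys) (X∩Y=∅ ∷ X∩Ys=∅) x∈X x∈⋃ with x∈p∪q⁻ Y (⋃ Ys) x∈⋃
... | inj₁ x∈Y   = X∩Y=∅ (_ , x∈p∩q⁺ (x∈X , x∈Y))
... | inj₂ x∈⋃Ys = ∉⋃ Ys X∩Ys=∅ x∈X x∈⋃Ys

∣p∩r∣-─⋃ : ∀ {p : Subset n} r Xs → AllPairs Disjoint Xs → All (_⊆ p) Xs →
           ∣ p ∩ r ∣ ≡ ∣ (p ─ ⋃ Xs) ∩ r ∣ + sum (map (λ X → ∣ X ∩ r ∣) Xs)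
∣p∩r∣-─⋃ {p = p} r [] [] [] = sym (trans (+-identityʳ _) (cong (λ w → ∣ w ∩ r ∣) (p─⊥≡p p)))
∣p∩r∣-─⋃ {p = p} r (X ∷ Xs) (X∩Xs=∅ ∷ Xs-disjoint) (X⊆p ∷ Xs⊆p) = begin
  ∣ p ∩ r ∣                                     ≡⟨ ∣p∩r∣-─⋃ r Xs Xs-disjoint Xs⊆p ⟩
  ∣ (p ─ ⋃ Xs) ∩ r ∣ + rest                     ≡⟨ cong (_+ rest) (∣p∩r∣-split r X⊆p─⋃Xs) ⟩
  ∣ (p ─ ⋃ Xs ─ X) ∩ r ∣ + ∣ X ∩ r ∣ + rest     ≡⟨ +-assoc _ (∣ X ∩ r ∣) rest ⟩
  ∣ (p ─ ⋃ Xs ─ X) ∩ r ∣ + (∣ X ∩ r ∣ + rest)   ≡⟨ cong (λ w → ∣ w ∩ r ∣ + (∣ X ∩ r ∣ + rest)) p─⋃Xs─X ⟩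
  ∣ (p ─ ⋃ (X ∷ Xs)) ∩ r ∣ + (∣ X ∩ r ∣ + rest) ∎
  where
  open ≡-Reasoning
  rest : ℕ
  rest = sum (map (λ X → ∣ X ∩ r ∣) Xs)
  X⊆p─⋃Xs : X ⊆ p ─ ⋃ Xs
  X⊆p─⋃Xs x∈X = x∈p∧x∉q⇒x∈p─q (X⊆p x∈X) (∉⋃ Xs X∩Xs=∅ x∈X)
  p─⋃Xs─X : p ─ ⋃ Xs ─ X ≡ p ─ ⋃ (X ∷ Xs)
  p─⋃Xs─X = trans (p─q─r≡p─r─q p (⋃ Xs) X) (p─q─r≡p─q∪r p X (⋃ Xs))

allSubsets : ∀ n → List (Subset n)
allSubsets zero    = [] ∷ []
allSubsets (suc n) = cartesianProductWith _∷_ (inside ∷ outside ∷ []) (allSubsets n)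

∈-allSubsets : ∀ (p : Subset n) → p ∈ₗ allSubsets n
∈-allSubsets []      = Any.here refl
∈-allSubsets (x ∷ p) = ∈-cartesianProductWith⁺ _∷_ (x∈bits x) (∈-allSubsets p)
  where
  x∈bits : ∀ x → x ∈ₗ inside ∷ outside ∷ []
  x∈bits true  = Any.here refl
  x∈bits false = Any.there (Any.here refl)

allSubsets-unique : ∀ n → Unique (allSubsets n)
allSubsets-unique zero    = [] ∷ []
allSubsets-unique (suc n) =
  Uniqueₚ.cartesianProductWith⁺ _∷_ ∷-injective ((inside≢outside ∷ []) ∷ [] ∷ []) (allSubsets-unique n)
  where
  inside≢outside : inside ≢ outside
  inside≢outside ()

AllPairs-resp-⊑ : ∀ {a ℓ} {A : Set a} {R : Rel A ℓ} {xs ys} → xs ⊑ ys → AllPairs R ys → AllPairs R xs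
AllPairs-resp-⊑ []           []         = []
AllPairs-resp-⊑ (_ ∷ʳ xs⊑)   (_ ∷ Rys)  = AllPairs-resp-⊑ xs⊑ Rys
AllPairs-resp-⊑ (refl ∷ xs⊑) (Ry ∷ Rys) = All-resp-⊆ xs⊑ Ry ∷ AllPairs-resp-⊑ xs⊑ Rys

infixl 6 _⊕_
infix 7 _·_

_⊕_ : Subset n → Subset n → Subset n
_⊕_ = zipWith _xor_

∣_∣₂ : Subset n → Bool
∣ [] ∣₂    = false
∣ x ∷ p ∣₂ = x xor ∣ p ∣₂

_·_ : Subset n → Subset n → Bool
p · q = ∣ p ∩ q ∣₂

Σ⊕ : List (Subset n) → Subset n
Σ⊕ = foldr _⊕_ ⊥

∣p∣≡∣p∣₂ : (p : Subset n) → ∣ p ∣ ≡ bit ∣ p ∣₂ [mod 2 ]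
∣p∣≡∣p∣₂ []            = ≡⇒≡-mod refl
∣p∣≡∣p∣₂ (outside ∷ p) = ∣p∣≡∣p∣₂ p
∣p∣≡∣p∣₂ (inside ∷ p)  =
  mod-trans (+-cong-mod {a = 1} (≡⇒≡-mod refl) (∣p∣≡∣p∣₂ p)) (bit-+-mod2 true ∣ p ∣₂)

mod2⇒∣p∣₂ : ∀ {c} (p : Subset n) → ∣ p ∣ ≡ bit c [mod 2 ] → ∣ p ∣₂ ≡ c
mod2⇒∣p∣₂ p h = bit-injective-mod2 (mod-trans (mod-sym (∣p∣≡∣p∣₂ p)) h)

∣p∣₂⇒mod2 : ∀ {c} (p : Subset n) → ∣ p ∣₂ ≡ c → ∣ p ∣ ≡ bit c [mod 2 ]
∣p∣₂⇒mod2 p refl = ∣p∣≡∣p∣₂ p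

∣⊥∣₂ : ∀ n → ∣ ⊥ {n} ∣₂ ≡ false
∣⊥∣₂ zero    = refl
∣⊥∣₂ (suc n) = ∣⊥∣₂ n

∣p⊕q∣₂ : (p q : Subset n) → ∣ p ⊕ q ∣₂ ≡ ∣ p ∣₂ xor ∣ q ∣₂
∣p⊕q∣₂ []      []      = refl
∣p⊕q∣₂ (x ∷ p) (y ∷ q) = trans (cong ((x xor y) xor_) (∣p⊕q∣₂ p q)) (interchange x y ∣ p ∣₂ ∣ q ∣₂)

∩-distribʳ-⊕ : (p q r : Subset n) → (p ⊕ q) ∩ r ≡ (p ∩ r) ⊕ (q ∩ r)
∩-distribʳ-⊕ []      []      []      = refl
∩-distribʳ-⊕ (x ∷ p) (y ∷ q) (z ∷ r) = cong₂ _∷_ (∧-distribʳ-xor z x y) (∩-distribʳ-⊕ p q r)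

·-distribʳ-⊕ : (p q r : Subset n) → (p ⊕ q) · r ≡ p · r xor q · r
·-distribʳ-⊕ p q r = trans (cong ∣_∣₂ (∩-distribʳ-⊕ p q r)) (∣p⊕q∣₂ (p ∩ r) (q ∩ r))

·-comm : (p q : Subset n) → p · q ≡ q · p
·-comm p q = cong ∣_∣₂ (∩-comm p q)

·-distribˡ-⊕ : (p q r : Subset n) → r · (p ⊕ q) ≡ r · p xor r · q
·-distribˡ-⊕ p q r =
  trans (·-comm r (p ⊕ q)) (trans (·-distribʳ-⊕ p q r) (cong₂ _xor_ (·-comm p r) (·-comm q r)))

⊕-cancelˡ : (p q : Subset n) → p ⊕ (p ⊕ q) ≡ q
⊕-cancelˡ []      []      = refl
⊕-cancelˡ (x ∷ p) (y ∷ q) =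
  cong₂ _∷_ (trans (sym (xor-assoc x x y)) (cong (_xor y) (xor-same x))) (⊕-cancelˡ p q)

∣p∣₂≡true⇒Nonempty : (p : Subset n) → ∣ p ∣₂ ≡ true → Nonempty p
∣p∣₂≡true⇒Nonempty {n} p odd with nonempty? p
... | yes ne = ne
... | no  ¬ne with () ← trans (sym odd) (trans (cong ∣_∣₂ (Empty-unique ¬ne)) (∣⊥∣₂ n))

x∈p⇒p·⁅x⁆≡true : ∀ {x : Fin n} {p} → x ∈ p → p · ⁅ x ⁆ ≡ true
x∈p⇒p·⁅x⁆≡true {x = x} {p} x∈p = begin
  ∣ p ∩ ⁅ x ⁆ ∣₂ ≡⟨ cong ∣_∣₂ (trans (∩-comm p ⁅ x ⁆) (p⊆q⇒p∩q≡p ⁅x⁆⊆p)) ⟩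
  ∣ ⁅ x ⁆ ∣₂     ≡⟨ mod2⇒∣p∣₂ ⁅ x ⁆ (≡⇒≡-mod (∣⁅x⁆∣≡1 x)) ⟩
  true           ∎
  where
  open ≡-Reasoning
  ⁅x⁆⊆p : ⁅ x ⁆ ⊆ p
  ⁅x⁆⊆p y∈⁅x⁆ = subst (_∈ p) (sym (x∈⁅y⁆⇒x≡y x y∈⁅x⁆)) x∈p

Orthogonal : Subset n → List (Subset n) → Set
Orthogonal y = All (λ s → s · y ≡ false)

SubsetSum : List (Subset n) → Subset n → Set
SubsetSum S t = ∃[ T ] T ⊑ S × Σ⊕ T ≡ t

Separator : List (Subset n) → Subset n → Set
Separator S t = ∃[ y ] Orthogonal y S × t · y ≡ true

-- One of y, z and y ⊕ z is also orthogonal to s.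
separator-∷ : ∀ {s S} {t : Subset n} → Separator S t → Separator S (s ⊕ t) → Separator (s ∷ S) t
separator-∷ {s = s} {S} {t} (y , y⊥S , t·y) (z , z⊥S , [s⊕t]·z) with s · y in s·y | s · z in s·z
... | false | _     = y , s·y ∷ y⊥S , t·y
... | true  | false =
  z , s·z ∷ z⊥S , trans (cong (_xor t · z) (sym s·z)) (trans (sym (·-distribʳ-⊕ s t z)) [s⊕t]·z)
... | true  | true  = y ⊕ z , s·[y⊕z] ∷ All.zipWith (λ {r} → orthogonal {r}) (y⊥S , z⊥S) , t·[y⊕z]
  where
  open ≡-Reasoning
  orthogonal : ∀ {r} → r · y ≡ false × r · z ≡ false → r · (y ⊕ z) ≡ false
  orthogonal {r} (r·y , r·z) = trans (·-distribˡ-⊕ y z r) (cong₂ _xor_ r·y r·z)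
  s·[y⊕z] : s · (y ⊕ z) ≡ false
  s·[y⊕z] = trans (·-distribˡ-⊕ y z s) (cong₂ _xor_ s·y s·z)
  t·[y⊕z] : t · (y ⊕ z) ≡ true
  t·[y⊕z] = begin
    t · (y ⊕ z)       ≡⟨ ·-distribˡ-⊕ y z t ⟩
    t · y xor t · z   ≡⟨ cong (_xor t · z) (trans t·y (sym s·z)) ⟩
    s · z xor t · z   ≡⟨ sym (·-distribʳ-⊕ s t z) ⟩
    (s ⊕ t) · z       ≡⟨ [s⊕t]·z ⟩
    true              ∎

subsetSum⊎separator : ∀ S (t : Subset n) → SubsetSum S t ⊎ Separator S t
subsetSum⊎separator [] t with nonempty? t
... | yes (x , x∈t) = inj₂ (⁅ x ⁆ , [] , x∈p⇒p·⁅x⁆≡true x∈t)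
... | no  t-empty   = inj₁ ([] , [] , sym (Empty-unique t-empty))
subsetSum⊎separator (s ∷ S) t with subsetSum⊎separator S t | subsetSum⊎separator S (s ⊕ t)
... | inj₁ (T , T⊑S , ΣT≡t) | _ = inj₁ (T , s ∷ʳ T⊑S , ΣT≡t)
... | inj₂ _   | inj₁ (T , T⊑S , ΣT≡s⊕t) =
  inj₁ (s ∷ T , refl ∷ T⊑S , trans (cong (s ⊕_) ΣT≡s⊕t) (⊕-cancelˡ s t))
... | inj₂ sep | inj₂ sep′ = inj₂ (separator-∷ sep sep′)

Σ⊕-orthogonal : ∀ {y : Subset n} S → Orthogonal y S → Σ⊕ S · y ≡ false
Σ⊕-orthogonal {n} {y} []      []            = trans (cong ∣_∣₂ (∩-zeroˡ y)) (∣⊥∣₂ n)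
Σ⊕-orthogonal {y = y} (s ∷ S) (s·y ∷ S⊥y) =
  trans (·-distribʳ-⊕ s (Σ⊕ S) y) (cong₂ _xor_ s·y (Σ⊕-orthogonal S S⊥y))

module _ {n} (G : Graph n) (q : ℕ) (A U : Subset n) where

  -- The set counted by nB, so that nB G A U B ≡ ∣ withTrace B ∣ holds by refl.
  withTrace : Subset n → Subset n
  withTrace B = tabulate (λ x → lookup (A ─ U) x ∧ ⌊ ≡-dec _≟ᵇ_ (trace G x U) B ⌋)

  ∈-withTrace⁻ : ∀ {x B} → x ∈ withTrace B → x ∈ A ─ U × trace G x U ≡ B
  ∈-withTrace⁻ {x} {B} x∈ with lookup (A ─ U) x in x∈A─U | ≡-dec _≟ᵇ_ (trace G x U) B
                             | trans (sym (lookup∘tabulate _ x)) ([]=⇒lookup x∈)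
  ... | true  | yes x↦B | _  = lookup⇒[]= x (A ─ U) x∈A─U , x↦B
  ... | true  | no  _   | ()
  ... | false | _       | ()

  ∈-withTrace⁺ : ∀ {x B} → x ∈ A ─ U → trace G x U ≡ B → x ∈ withTrace B
  ∈-withTrace⁺ {x} {B} x∈A─U x↦B = lookup⇒[]= x (withTrace B) (trans (lookup∘tabulate _ x)
    (cong₂ _∧_ ([]=⇒lookup x∈A─U) (Equivalence.to T-≡ (fromWitness x↦B))))

  Available : Subset n → Set
  Available B = B ⊆ U × q ≤ nB G A U B

  available? : Decidable Available
  available? B = B ⊆? U ×-dec q ≤? nB G A U B

  availableTraces : List (Subset n)
  availableTraces = filter available? (allSubsets n)

  Block : Subset n → Subset n → Set
  Block B X = X ⊆ withTrace B × ∣ X ∣ ≡ q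

  IsBlock : Subset n → Set
  IsBlock X = (X ⊆ (A ─ U)) × (∣ X ∣ ≡ q)
              × (∀ x y → x ∈ X → y ∈ X → trace G x U ≡ trace G y U)

  Block⇒IsBlock : ∀ {B X} → Block B X → IsBlock X
  Block⇒IsBlock (X⊆ , ∣X∣≡q) = proj₁ ∘ ∈-withTrace⁻ ∘ X⊆ , ∣X∣≡q ,
    λ x y x∈X y∈X → trans (proj₂ (∈-withTrace⁻ (X⊆ x∈X))) (sym (proj₂ (∈-withTrace⁻ (X⊆ y∈X))))

  IsBlock⇒Block : .{{_ : NonZero q}} → ∀ {X} → IsBlock X → ∃[ B ] Available B × Block B X
  IsBlock⇒Block {X} (X⊆A─U , ∣X∣≡q , sameTrace) with nonempty? X
  ... | no X-empty    =
    contradiction (trans (sym ∣X∣≡q) (trans (cong ∣_∣ (Empty-unique X-empty)) (∣⊥∣≡0 n))) (≢-nonZero⁻¹ q)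
  ... | yes (x , x∈X) = trace G x U , (p∩q⊆q (N G x) U , q≤nB) , X⊆withTrace , ∣X∣≡q
    where
    X⊆withTrace : X ⊆ withTrace (trace G x U)
    X⊆withTrace y∈X = ∈-withTrace⁺ (X⊆A─U y∈X) (sameTrace _ x y∈X x∈X)
    q≤nB : q ≤ nB G A U (trace G x U)
    q≤nB = subst (_≤ nB G A U (trace G x U)) ∣X∣≡q (p⊆q⇒∣p∣≤∣q∣ X⊆withTrace)

  blocksOf : .{{_ : NonZero q}} → ∀ {Xs} → All IsBlock Xs → ∃[ Bs ] All Available Bs × Pointwise Block Bs Xs
  blocksOf []                          = [] , [] , []
  blocksOf (X-isBlock ∷ Xs-areBlocks)
    with B , B-available , X-block ← IsBlock⇒Block X-isBlock
       | Bs , Bs-available , blocks ← blocksOf Xs-areBlocks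
       = B ∷ Bs , B-available ∷ Bs-available , X-block ∷ blocks

  blocks⊆A : ∀ {Bs Xs} → Pointwise Block Bs Xs → All (_⊆ A) Xs
  blocks⊆A []                  = []
  blocks⊆A ((X⊆ , _) ∷ blocks) = (p─q⊆p A U ∘ proj₁ ∘ ∈-withTrace⁻ ∘ X⊆) ∷ blocks⊆A blocks

  block : Subset n → Subset n
  block B = keepFirst q (withTrace B)

  block-Block : ∀ {B} → Available B → Block B (block B)
  block-Block {B} (_ , q≤nB) = keepFirst-⊆ q (withTrace B) , ∣keepFirst∣ (withTrace B) q≤nB

  block-Pointwise : ∀ {T} → All Available T → Pointwise Block T (map block T)
  block-Pointwise []                          = []
  block-Pointwise (B-available ∷ T-available) = block-Block B-available ∷ block-Pointwise T-available

  ∈-block⇒trace : ∀ {x B} → x ∈ block B → trace G x U ≡ B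
  ∈-block⇒trace {B = B} x∈B = proj₂ (∈-withTrace⁻ (keepFirst-⊆ q (withTrace B) x∈B))

  block-disjoint : ∀ {B B′} → B ≢ B′ → Disjoint (block B) (block B′)
  block-disjoint {B} {B′} B≢B′ (x , x∈both) with x∈p∩q⁻ (block B) (block B′) x∈both
  ... | x∈B , x∈B′ = B≢B′ (trans (sym (∈-block⇒trace x∈B)) (∈-block⇒trace x∈B′))

  lookup-N≡lookup-trace : ∀ {u x} → u ∈ U → lookup (N G u) x ≡ lookup (trace G x U) u
  lookup-N≡lookup-trace {u} {x} u∈U = begin
    lookup (N G u) x               ≡⟨ lookup∘tabulate (adj G u) x ⟩
    adj G u x                      ≡⟨ Graph.sym G u x ⟩
    adj G x u                      ≡⟨ sym (∧-identityʳ (adj G x u)) ⟩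
    adj G x u ∧ true               ≡⟨ sym (cong₂ _∧_ (lookup∘tabulate (adj G x) u) ([]=⇒lookup u∈U)) ⟩
    lookup (N G x) u ∧ lookup U u  ≡⟨ sym (lookup-zipWith _∧_ u (N G x) U) ⟩
    lookup (trace G x U) u         ∎
    where open ≡-Reasoning

  ∣Block∩N∣ : ∀ {B X u} → Block B X → u ∈ U → ∣ X ∩ N G u ∣ ≡ q * bit (lookup B u)
  ∣Block∩N∣ {B} {X} {u} (X⊆ , ∣X∣≡q) u∈U =
    trans (cong ∣_∣ (∩-constant neighbours)) (size (lookup B u))
    where
    neighbours : ∀ {x} → x ∈ X → lookup (N G u) x ≡ lookup B u
    neighbours x∈X =
      trans (lookup-N≡lookup-trace u∈U) (cong (λ T → lookup T u) (proj₂ (∈-withTrace⁻ (X⊆ x∈X))))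
    size : ∀ c → ∣ if c then X else ⊥ ∣ ≡ q * bit c
    size true  = trans ∣X∣≡q (sym (*-identityʳ q))
    size false = trans (∣⊥∣≡0 n) (sym (*-zeroʳ q))

  removed-degree : ∀ {Bs Xs u} → Pointwise Block Bs Xs → u ∈ U →
                   sum (map (λ X → ∣ X ∩ N G u ∣) Xs) ≡ q * bit (lookup (Σ⊕ Bs) u) [mod 2 * q ]
  removed-degree {u = u} [] _ =
    ≡⇒≡-mod (sym (trans (cong (λ c → q * bit c) (lookup-replicate u false)) (*-zeroʳ q)))
  removed-degree {B ∷ Bs} {X ∷ Xs} {u} (X-block ∷ blocks) u∈U = begin
    ∣ X ∩ N G u ∣ + sum (map (λ X → ∣ X ∩ N G u ∣) Xs)
      ≈⟨ +-cong-mod (≡⇒≡-mod (∣Block∩N∣ X-block u∈U)) (removed-degree blocks u∈U) ⟩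
    q * bit (lookup B u) + q * bit (lookup M u)
      ≡⟨ sym (*-distribˡ-+ q _ _) ⟩
    q * (bit (lookup B u) + bit (lookup M u))
      ≈⟨ *-congˡ-mod q (bit-+-mod2 (lookup B u) (lookup M u)) ⟩
    q * bit (lookup B u xor lookup M u)
      ≡⟨ cong (λ c → q * bit c) (sym (lookup-zipWith _xor_ u B M)) ⟩
    q * bit (lookup (B ⊕ M) u)
      ∎
    where
    open ≈-Reasoning (mod-setoid (2 * q))
    M : Subset n
    M = Σ⊕ Bs

  module _ (U⊆A : U ⊆ A) (d : ℕ) (b : Fin n → Bool)
           (hb : ∀ v → v ∈ A → deg G A v ≡ d + q * bit (b v) [mod 2 * q ]) where

    degree-after-deletion : ∀ {Bs Xs u} → Pointwise Block Bs Xs → AllPairs Disjoint Xs → u ∈ U →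
                            deg G (A ─ ⋃ Xs) u ≡ d + q * bit (b u xor lookup (Σ⊕ Bs) u) [mod 2 * q ]
    degree-after-deletion {Bs} {Xs} {u} blocks disjoint u∈U =
      remove-bit-mod q (b u) (lookup (Σ⊕ Bs) u)
        (sym (∣p∩r∣-─⋃ (N G u) Xs disjoint (blocks⊆A blocks)))
        (removed-degree blocks u∈U)
        (hb u (U⊆A u∈U))

    deletionFamily : ∀ {T} c → T ⊑ availableTraces → (∀ {u} → u ∈ U → b u xor lookup (Σ⊕ T) u ≡ c) →
                     DeletionFamily G q A U (map block T)
    deletionFamily {T} c T⊑ balanced =
      disjoint , Allₚ.map⁺ (All.map (Block⇒IsBlock ∘ block-Block) T-available) ,
      λ u v u∈U v∈U → mod-trans (≡d+q*bit-c u∈U) (mod-sym (≡d+q*bit-c v∈U))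
      where
      T-available : All Available T
      T-available = All-resp-⊆ T⊑ (Allₚ.all-filter available? (allSubsets n))
      disjoint : AllPairs Disjoint (map block T)
      disjoint = AllPairsₚ.map⁺ (AllPairs.map block-disjoint
                   (AllPairs-resp-⊑ T⊑ (Uniqueₚ.filter⁺ available? (allSubsets-unique n))))
      ≡d+q*bit-c : ∀ {u} → u ∈ U → deg G (A ─ ⋃ (map block T)) u ≡ d + q * bit c [mod 2 * q ]
      ≡d+q*bit-c {u} u∈U = subst (λ z → deg G (A ─ ⋃ (map block T)) u ≡ d + q * bit z [mod 2 * q ])
                                 (balanced u∈U) (degree-after-deletion (block-Pointwise T-available) disjoint u∈U)

    obstruction-from-separator : ∀ {y} → U · y ≡ false → Orthogonal y availableTraces →
                                 (tabulate b ∩ U) · y ≡ true → EvenObstruction G q A U b (U ∩ y)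
    obstruction-from-separator {y} U·y≡0 y⊥available [b∩U]·y≡1 =
      p∩q⊆p U y , nonempty , ∣p∣₂⇒mod2 (U ∩ y) U·y≡0 ,
      ∣p∣₂⇒mod2 ((U ∩ y) ∩ tabulate b) [U∩y]·b≡1 , orthogonal
      where
      [U∩y]·b≡1 : (U ∩ y) · tabulate b ≡ true
      [U∩y]·b≡1 = trans (cong ∣_∣₂ (trans (∩-comm (U ∩ y) (tabulate b)) (sym (∩-assoc (tabulate b) U y))))
                        [b∩U]·y≡1
      nonempty : Nonempty (U ∩ y)
      nonempty with x , x∈ ← ∣p∣₂≡true⇒Nonempty ((U ∩ y) ∩ tabulate b) [U∩y]·b≡1 =
        x , proj₁ (x∈p∩q⁻ _ _ x∈)
      orthogonal : ∀ B → B ⊆ U → q ≤ nB G A U B → ∣ B ∩ (U ∩ y) ∣ ≡ 0 [mod 2 ]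
      orthogonal B B⊆U q≤nB = ∣p∣₂⇒mod2 (B ∩ (U ∩ y)) (trans (cong ∣_∣₂ B∩[U∩y]≡B∩y) B·y≡0)
        where
        B∩[U∩y]≡B∩y : B ∩ (U ∩ y) ≡ B ∩ y
        B∩[U∩y]≡B∩y = trans (sym (∩-assoc B U y)) (cong (_∩ y) (p⊆q⇒p∩q≡p B⊆U))
        B·y≡0 : B · y ≡ false
        B·y≡0 = All.lookup y⊥available (∈-filter⁺ available? (∈-allSubsets B) (B⊆U , q≤nB))

    Balanced : List (Subset n) → Set
    Balanced Xs = ∀ u v → u ∈ U → v ∈ U → deg G (A ─ ⋃ Xs) u ≡ deg G (A ─ ⋃ Xs) v [mod 2 * q ]

    -- Z = b ⊕ Σ⊕ Bs is constant on y, so the evenness of y gives Z · y ≡ false; but y is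
    -- orthogonal to every B and Z · y ≡ b · y ≡ true.
    balanced-blocks-refute-obstruction :
      .{{_ : NonZero q}} → ∀ {Bs Xs y} → All Available Bs → Pointwise Block Bs Xs → AllPairs Disjoint Xs →
      Balanced Xs → ¬ EvenObstruction G q A U b y
    balanced-blocks-refute-obstruction {Bs} {Xs} {y} Bs-available blocks disjoint balanced
      (y⊆U , (u₀ , u₀∈y) , ∣y∣-even , ∣y∩b∣-odd , y⊥available) =
      contradiction (trans (sym Z·y≡true) Z·y≡false) λ ()
      where
      M Z : Subset n
      M = Σ⊕ Bs
      Z = tabulate b ⊕ M
      κ : Bool
      κ = b u₀ xor lookup M u₀
      residue : ∀ {u} → u ∈ U → deg G (A ─ ⋃ Xs) u ≡ d + q * bit (b u xor lookup M u) [mod 2 * q ]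
      residue = degree-after-deletion blocks disjoint
      Z-constant : ∀ {x} → x ∈ y → lookup Z x ≡ κ
      Z-constant {x} x∈y = begin
        lookup Z x                           ≡⟨ lookup-zipWith _xor_ x (tabulate b) M ⟩
        lookup (tabulate b) x xor lookup M x ≡⟨ cong (_xor lookup M x) (lookup∘tabulate b x) ⟩
        b x xor lookup M x                   ≡⟨ d+q*bit-injective d q residue-x≡residue-u₀ ⟩
        κ                                    ∎
        where
        open ≡-Reasoning
        residue-x≡residue-u₀ : (d + q * bit (b x xor lookup M x)) ≡ d + q * bit κ [mod 2 * q ]
        residue-x≡residue-u₀ = mod-trans (mod-sym (residue (y⊆U x∈y)))
                                 (mod-trans (balanced x u₀ (y⊆U x∈y) (y⊆U u₀∈y)) (residue (y⊆U u₀∈y)))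
      Z·y≡false : Z · y ≡ false
      Z·y≡false = trans (·-comm Z y) (trans (cong ∣_∣₂ (∩-constant Z-constant)) (parity κ))
        where
        parity : ∀ c → ∣ if c then y else ⊥ ∣₂ ≡ false
        parity true  = mod2⇒∣p∣₂ y ∣y∣-even
        parity false = ∣⊥∣₂ n
      M·y≡false : M · y ≡ false
      M·y≡false = Σ⊕-orthogonal Bs
        (All.map (λ {B} (B⊆U , q≤nB) → mod2⇒∣p∣₂ (B ∩ y) (y⊥available B B⊆U q≤nB)) Bs-available)
      Z·y≡true : Z · y ≡ true
      Z·y≡true = begin
        Z · y                     ≡⟨ ·-distribʳ-⊕ (tabulate b) M y ⟩
        tabulate b · y xor M · y  ≡⟨ cong₂ _xor_ b·y≡true M·y≡false ⟩
        true                      ∎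
        where
        open ≡-Reasoning
        b·y≡true : tabulate b · y ≡ true
        b·y≡true = trans (·-comm (tabulate b) y) (mod2⇒∣p∣₂ (y ∩ tabulate b) ∣y∩b∣-odd)

    deletionFamily-refutes-obstruction :
      .{{_ : NonZero q}} → ∀ {Xs y} → DeletionFamily G q A U Xs → ¬ EvenObstruction G q A U b y
    deletionFamily-refutes-obstruction (disjoint , areBlocks , balanced)
      with _ , Bs-available , blocks ← blocksOf areBlocks
      = balanced-blocks-refute-obstruction Bs-available blocks disjoint balanced

    lookup-b∩U : ∀ {u} → u ∈ U → lookup (tabulate b ∩ U) u ≡ b u
    lookup-b∩U {u} u∈U = trans (lookup-zipWith _∧_ u (tabulate b) U)
                           (trans (cong₂ _∧_ (lookup∘tabulate b u) ([]=⇒lookup u∈U)) (∧-identityʳ (b u)))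

    -- Generating with U as well lets the common value of b + Σ⊕ T on U be either false or true.
    dichotomy : Σ (List (Subset n)) (DeletionFamily G q A U) ⊎ Σ (Subset n) (EvenObstruction G q A U b)
    dichotomy with subsetSum⊎separator (U ∷ availableTraces) (tabulate b ∩ U)
    ... | inj₁ (T , _ ∷ʳ T⊑ , ΣT≡b∩U) = inj₁ (map block T , deletionFamily false T⊑ balanced)
      where
      balanced : ∀ {u} → u ∈ U → b u xor lookup (Σ⊕ T) u ≡ false
      balanced {u} u∈U = trans (cong (b u xor_) (trans (cong (λ p → lookup p u) ΣT≡b∩U) (lookup-b∩U u∈U)))
                               (xor-same (b u))
    ... | inj₁ (_ ∷ T , refl ∷ T⊑ , U⊕ΣT≡b∩U) = inj₁ (map block T , deletionFamily true T⊑ balanced)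
      where
      balanced : ∀ {u} → u ∈ U → b u xor lookup (Σ⊕ T) u ≡ true
      balanced {u} u∈U = begin
        b u xor M u                        ≡⟨ cong (_xor M u) (sym (lookup-b∩U u∈U)) ⟩
        lookup (tabulate b ∩ U) u xor M u  ≡⟨ cong (λ p → lookup p u xor M u) (sym U⊕ΣT≡b∩U) ⟩
        lookup (U ⊕ Σ⊕ T) u xor M u        ≡⟨ cong (_xor M u) (lookup-zipWith _xor_ u U (Σ⊕ T)) ⟩
        (lookup U u xor M u) xor M u       ≡⟨ xor-cancelʳ (lookup U u) (M u) ⟩
        lookup U u                         ≡⟨ []=⇒lookup u∈U ⟩
        true                               ∎
        where
        open ≡-Reasoning
        M : Fin n → Bool
        M = lookup (Σ⊕ T)
    ... | inj₂ (y , U·y≡false ∷ y⊥available , [b∩U]·y≡true) =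
      inj₂ (U ∩ y , obstruction-from-separator U·y≡false y⊥available [b∩U]·y≡true)

mainTheorem10 : ∀ {n} (G : Graph n) (q k : ℕ) → q ≡ 2 ^ k →
    (A U : Subset n) → Modular G q A → U ⊆ A →
    (d : ℕ) → (∀ v → v ∈ A → deg G A v ≡ d [mod q ]) →
    (b : Fin n → Bool) →
    (∀ v → v ∈ A → deg G A v ≡ d + q * (if b v then 1 else 0) [mod 2 * q ]) →
    ((¬ Σ (List (Subset n)) (DeletionFamily G q A U))
       ⇔ Σ (Subset n) (EvenObstruction G q A U b))
    × ((Σ (List (Subset n)) (DeletionFamily G q A U)
         ⊎ Σ (Subset n) (EvenObstruction G q A U b))
       × ¬ (Σ (List (Subset n)) (DeletionFamily G q A U)
            × Σ (Subset n) (EvenObstruction G q A U b)))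
mainTheorem10 {n} G q k q≡2^k A U _ U⊆A d _ b hb =
  mk⇔ (λ no-family → fromInj₂ (⊥-elim ∘ no-family) one)
      (λ obstruction family → exclusive (family , obstruction)) ,
  one , exclusive
  where
  instance
    q≢0 : NonZero q
    q≢0 = subst NonZero (sym q≡2^k) (m^n≢0 2 k)
  one : Σ (List (Subset n)) (DeletionFamily G q A U) ⊎ Σ (Subset n) (EvenObstruction G q A U b)
  one = dichotomy G q A U U⊆A d b hb
  exclusive : ¬ (Σ (List (Subset n)) (DeletionFamily G q A U) × Σ (Subset n) (EvenObstruction G q A U b))
  exclusive ((_ , family) , (_ , obstruction)) =
    deletionFamily-refutes-obstruction G q A U U⊆A d b hb family obstruction
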